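{- Let $(G_1,\sigma_1,\prec_1)$ and $(G_2,\sigma_2,\prec_2)$ be admissible UPO-graphs such that $G_1$ has $n$ output edges $o_1\prec_1\cdots\prec_1 o_n$ and $G_2$ has $n$ input edges $i_1\prec_2\cdots\prec_2 i_n$, and let $G=G_2\circ G_1$ with composed linear order $\prec=\prec_2\circ\prec_1$. Let $v$ be a processive vertex of $G$ (i.e. both $I(v)$ and $O(v)$ are nonempty). Then $\min O(v)$ is the immediate successor of $\max I(v)$ in $(E(G),\prec)$.
   Context: Directed graphs are finite, may have multiple edges, and each edge $e$ has source $s(e)$ and target $t(e)$. $I(v)$, $O(v)$ denote the incoming and outgoing edges of a vertex $v$, and $E(v)=I(v)\cup O(v)$. $e_1\to e_2$ means there is a directed path starting with edge $e_1$ and ending with edge $e_2$. For a subset $X$ of a finite linearly ordered set, $\overline{X}$ is the set of elements between $\min X$ and $\max X$ inclusive. An upward planar order on a finite acyclic directed graph $G$ is a linear order $\prec$ on $E(G)$ such that (i) $e_1\to e_2$ implies $e_1\prec e_2$; (ii) for every vertex $v$, $\overline{I(v)}\cap\overline{O(v)}=\emptyset$ and $\overline{E(v)}=\overline{I(v)}\sqcup\overline{O(v)}$; (iii) for any vertices $v_1,v_2$, $I(v_1)\cap\overline{I(v_2)}\neq\emptyset$ implies $\overline{I(v_1)}\subseteq\overline{I(v_2)}$, and $O(v_1)\cap\overline{O(v_2)}\neq\emptyset$ implies $\overline{O(v_1)}\subseteq\overline{O(v_2)}$. A progressive graph $(G,\sigma)$ is a finite acyclic directed graph $G$ with a distinguished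 subset $\sigma$ of vertices of degree one (boundary vertices); the other vertices are inner vertices. Boundary sources are input vertices, boundary sinks are output vertices. Edges starting at a boundary vertex are input edges, forming $I(G)$; edges ending at a boundary vertex are output edges, forming $O(G)$. An upward planar order $\prec$ on $(G,\sigma)$ is admissible if for every inner vertex $v$, $I(G)\cap\overline{O(v)}=\emptyset$ and $O(G)\cap\overline{I(v)}=\emptyset$; $(G,\sigma,\prec)$ is then an admissible UPO-graph. Composition: given $(G_1,\sigma_1,\prec_1)$ with output edges $o_1\prec_1\cdots\prec_1 o_n$ and $(G_2,\sigma_2,\prec_2)$ with input edges $i_1\prec_2\cdots\prec_2 i_n$, the graph $G=G_2\circ G_1$ is obtained by deleting the output vertices of $G_1$ and the input vertices of $G_2$ and, for each $k$, replacing $o_k$ and $i_k$ by a single edge $\overline{e_k}$ with source $s(o_k)$ and target $t(i_k)$; its boundary $\sigma$ consists of the input vertices of $G_1$ and the output vertices of $G_2$. Write $(E(G_1),\prec_1)$ as the consecutive blocks $Q_1,\{o_1\},Q_2,\{o_2\},\dots,Q_n,\{o_n\},Q_{n+1}$ (so $Q_1$ is the set of edges before $o_1$, $Q_k$ those strictly between $o_{k-1}$ and $o_k$, $Q_{n+1}$ those after $o_n$), and $(E(G_2),\prec_2)$ as $P_0,\{i_1\},P_1,\dots,\{i_n\},P_n$ similarly. The composed order $\prec=\prec_2\circ\prec_1$ on $E(G)$ is the linear order whose consecutive blocks are $P_0,Q_1,\{\overline{e_1}\},P_1,Q_2,\{\overline{e_2}\},P_2,\dots,Q_n,\{\overline{e_n}\},P_n,Q_{n+1}$,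 with each $Q_k$ ordered by $\prec_1$ and each $P_k$ by $\prec_2$. -}

module Defs where

open import Level using (0ℓ)
open import Data.Nat using (ℕ; _<_)
open import Data.Fin using (Fin; toℕ)
open import Data.Bool using (Bool; true; false; not; T)
open import Data.List using (List; length; filter; allFin)
open import Data.Product using (Σ; ∃; _×_; _,_)
open import Data.Sum using (_⊎_)
open import Data.Empty using (⊥)
open import Relation.Nullary using (¬_)
open import Relation.Binary using (Rel)
open import Relation.Binary.Structures using (IsStrictTotalOrder)
open import Relation.Binary.PropositionalEquality using (_≡_)

module _ {A : Set} (_≺_ : Rel A 0ℓ) where

  _≼_ : A → A → Set
  a ≼ b = a ≺ b ⊎ a ≡ b

  Hull : (A → Set) → A → Set
  Hull X x = ∃ λ a → ∃ λ b → X a × X b × a ≼ x × x ≼ b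

  IsMax : (A → Set) → A → Set
  IsMax X a = X a × (∀ e → X e → e ≼ a)

  IsMin : (A → Set) → A → Set
  IsMin X b = X b × (∀ e → X e → b ≼ e)

  ImmSucc : A → A → Set
  ImmSucc a b = a ≺ b × (∀ c → ¬ (a ≺ c × c ≺ b))

module _ {V E : ℕ} (s t : Fin E → Fin V) where

  data Path : Fin E → Fin E → Set where
    one  : ∀ {e₁ e₂} → t e₁ ≡ s e₂ → Path e₁ e₂
    more : ∀ {e₁ e e₂} → t e₁ ≡ s e → Path e e₂ → Path e₁ e₂

  Acyclic : Set
  Acyclic = ∀ e → ¬ Path e e

  Inc : Fin V → Fin E → Set
  Inc v e = s e ≡ v ⊎ t e ≡ v

  Iv : Fin V → Fin E → Set
  Iv v e = t e ≡ v

  Ov : Fin V → Fin E → Set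
  Ov v e = s e ≡ v

  DegOne : Fin V → Set
  DegOne v = ∃ λ e → Inc v e × (∀ e' → Inc v e' → e' ≡ e)

-- Admissible UPO-graphs.  The boundary σ is a Bool-valued predicate on
-- vertices; the order is a strict total order on the edges.

record AdmUPOGraph : Set₁ where
  field
    V E : ℕ
    s t : Fin E → Fin V
    σ   : Fin V → Bool
    _≺_ : Rel (Fin E) 0ℓ
    isSTO : IsStrictTotalOrder _≡_ _≺_
    acyclic : Acyclic s t
    boundaryDeg : ∀ v → σ v ≡ true → DegOne s t v
    upo-i : ∀ e₁ e₂ → Path s t e₁ e₂ → e₁ ≺ e₂
    upo-ii-disj : ∀ v x → ¬ (Hull _≺_ (Iv s t v) x × Hull _≺_ (Ov s t v) x)
    upo-ii-⊆ : ∀ v x → Hull _≺_ (Inc s t v) x →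
               Hull _≺_ (Iv s t v) x ⊎ Hull _≺_ (Ov s t v) x
    upo-ii-⊇ : ∀ v x → Hull _≺_ (Iv s t v) x ⊎ Hull _≺_ (Ov s t v) x →
               Hull _≺_ (Inc s t v) x
    upo-iii-I : ∀ v₁ v₂ → (∃ λ e → Iv s t v₁ e × Hull _≺_ (Iv s t v₂) e) →
                ∀ x → Hull _≺_ (Iv s t v₁) x → Hull _≺_ (Iv s t v₂) x
    upo-iii-O : ∀ v₁ v₂ → (∃ λ e → Ov s t v₁ e × Hull _≺_ (Ov s t v₂) e) →
                ∀ x → Hull _≺_ (Ov s t v₁) x → Hull _≺_ (Ov s t v₂) x
    adm-I : ∀ v → σ v ≡ false → ∀ e → σ (s e) ≡ true → ¬ Hull _≺_ (Ov s t v) e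
    adm-O : ∀ v → σ v ≡ false → ∀ e → σ (t e) ≡ true → ¬ Hull _≺_ (Iv s t v) e

  isInEdge : Fin E → Bool
  isInEdge e = σ (s e)

  isOutEdge : Fin E → Bool
  isOutEdge e = σ (t e)

  _<?_ = IsStrictTotalOrder._<?_ isSTO

open AdmUPOGraph

OutEnum : (G : AdmUPOGraph) (n : ℕ) → (Fin n → Fin (E G)) → Set
OutEnum G n o =
  (∀ k → isOutEdge G (o k) ≡ true) ×
  (∀ j k → toℕ j < toℕ k → _≺_ G (o j) (o k)) ×
  (∀ e → isOutEdge G e ≡ true → ∃ λ k → o k ≡ e)

InEnum : (G : AdmUPOGraph) (n : ℕ) → (Fin n → Fin (E G)) → Set
InEnum G n i =
  (∀ k → isInEdge G (i k) ≡ true) ×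
  (∀ j k → toℕ j < toℕ k → _≺_ G (i j) (i k)) ×
  (∀ e → isInEdge G e ≡ true → ∃ λ k → i k ≡ e)

countBefore : (G : AdmUPOGraph) (n : ℕ) → (Fin n → Fin (E G)) → Fin (E G) → ℕ
countBefore G n f e = length (filter (λ k → _<?_ G (f k) e) (allFin n))

module Compose (G₁ G₂ : AdmUPOGraph) (n : ℕ)
               (o : Fin n → Fin (E G₁)) (i : Fin n → Fin (E G₂)) where

  -- edges of G: Q-edges (non-output edges of G₁), merged edges ē_k,
  -- P-edges (non-input edges of G₂)
  data CEdge : Set where
    qE  : (e : Fin (E G₁)) → T (not (isOutEdge G₁ e)) → CEdge
    bar : Fin n → CEdge
    pE  : (e : Fin (E G₂)) → T (not (isInEdge G₂ e)) → CEdge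

  -- vertices of G are among the vertices of G₁ and G₂ (the deleted ones are
  -- incident to no edge of G)
  CVert : Set
  CVert = Fin (V G₁) ⊎ Fin (V G₂)

  src : CEdge → CVert
  src (qE e _) = _⊎_.inj₁ (s G₁ e)
  src (bar k)  = _⊎_.inj₁ (s G₁ (o k))
  src (pE e _) = _⊎_.inj₂ (s G₂ e)

  tgt : CEdge → CVert
  tgt (qE e _) = _⊎_.inj₁ (t G₁ e)
  tgt (bar k)  = _⊎_.inj₂ (t G₂ (i k))
  tgt (pE e _) = _⊎_.inj₂ (t G₂ e)

  -- block key: P_k ↦ (k,0), Q_{k+1} ↦ (k,1), ē_{k+1} ↦ (k,2), giving the block
  -- sequence P₀,Q₁,ē₁,P₁,Q₂,ē₂,…,Qₙ,ēₙ,Pₙ,Q_{n+1}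
  key : CEdge → ℕ × ℕ
  key (qE e _) = countBefore G₁ n o e , 1
  key (bar k)  = toℕ k , 2
  key (pE e _) = countBefore G₂ n i e , 0

  _<lex_ : ℕ × ℕ → ℕ × ℕ → Set
  (a , b) <lex (c , d) = a < c ⊎ (a ≡ c × b < d)

  within : CEdge → CEdge → Set
  within (qE e _) (qE e' _) = _≺_ G₁ e e'
  within (pE e _) (pE e' _) = _≺_ G₂ e e'
  within _ _ = ⊥

  _≺c_ : CEdge → CEdge → Set
  x ≺c y = key x <lex key y ⊎ (key x ≡ key y × within x y)

  Ic Oc : CVert → CEdge → Set
  Ic v e = tgt e ≡ v
  Oc v e = src e ≡ v

  Processive : CVert → Set
  Processive v = (∃ λ e → Ic v e) × (∃ λ e → Oc v e)

module Submission where

-- A vertex v of G₂ ∘ G₁ comes from G₁ or from G₂, and every edge of that graph becomes an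
-- edge of the composite (o_k, resp. i_k, becoming ē_k) in a way that preserves and reflects
-- the order. In the graph containing v, max I(v) and min O(v) are adjacent: condition (i)
-- orders them, and an edge strictly between them lies in the hull of E(v), hence by (ii) in
-- the hull of I(v) or of O(v), which is impossible. Adjacency survives composition because
-- edges of the other graph only fill whole blocks. If v comes from G₁, then max I(v) is not
-- an output edge, so no more output edges precede min O(v) than precede max I(v), and no
-- block P_m fits in between. If v comes from G₂, then min O(v) is not an input edge and no
-- more input edges precede it than are ≼ max I(v), so no block Q_m fits in between.

open import Defs
open import Data.Nat using (ℕ)
open import Data.Fin using (Fin)
open import Data.Product using (∃; _×_)

open import Level using (0ℓ)
open import Data.Bool using (Bool; true; false; not; T)
open import Data.Bool.Properties using (T-irrelevant)
open import Data.Empty using (⊥-elim)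
open import Data.Fin using (toℕ; zero; suc; _≟_)
open import Data.Fin.Properties using (toℕ-injective; toℕ<n)
open import Data.List using (List; length; filter; tabulate; allFin)
open import Data.List.Membership.Propositional using (_∈_)
open import Data.List.Membership.Propositional.Properties using (∈-filter⁺; ∈-allFin)
open import Data.List.Relation.Binary.Sublist.Heterogeneous.Properties using (length-mono-≤)
open import Data.List.Relation.Binary.Sublist.Propositional using (⊆-refl)
open import Data.List.Relation.Binary.Sublist.Propositional.Properties using (filter⁺)
open import Data.List.Relation.Unary.All using (lookup)
open import Data.List.Relation.Unary.All.Properties using (all-filter)
import Data.List.Extrema as Extrema
open import Data.Nat as ℕ using (zero; suc; _≤_; _<_; z≤n; s≤s; z<s)
open import Data.Nat.Properties as ℕ using (<-cmp; m≤n⇒m<n∨m≡n)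
open import Data.Product using (_,_; proj₁; proj₂)
open import Data.Product.Relation.Binary.Lex.Strict using (×-asymmetric)
open import Data.Sum using (inj₁; inj₂)
open import Data.Sum.Properties using (inj₁-injective; inj₂-injective)
open import Function using (id; _∘_; case_of_)
open import Relation.Binary using (Rel; Asymmetric; Transitive; tri<; tri≈; tri>)
open import Relation.Binary.Bundles using (StrictTotalOrder; DecTotalOrder)
open import Relation.Binary.Structures using (IsStrictTotalOrder)
import Relation.Binary.Construct.StrictToNonStrict as StrictToNonStrict
import Relation.Binary.Properties.StrictTotalOrder as StrictTotalOrderProperties
open import Relation.Binary.PropositionalEquality using (_≡_; refl; sym; trans; cong; cong₂; subst; resp₂; isEquivalence; module ≡-Reasoning)
open import Relation.Nullary using (¬_; yes; no; contradiction)
open import Relation.Unary using (Pred; Decidable; _⊆_)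

module _ {A : Set} {P : Pred A 0ℓ} (P? : Decidable P) where

  length-filter-tabulate-≥ : ∀ {n} (g : Fin n → A) {k} → k ≤ n →
                             (∀ j → toℕ j < k → P (g j)) →
                             k ≤ length (filter P? (tabulate g))
  length-filter-tabulate-≥ g {zero} _ _ = z≤n
  length-filter-tabulate-≥ g {suc k} (s≤s k≤n) below with P? (g zero)
  ... | yes _ = s≤s (length-filter-tabulate-≥ (g ∘ suc) k≤n (λ j j<k → below (suc j) (s≤s j<k)))
  ... | no ¬p = contradiction (below zero z<s) ¬p

  length-filter-tabulate-≤ : ∀ {n} (g : Fin n → A) {k} →
                             (∀ j → P (g j) → toℕ j < k) →
                             length (filter P? (tabulate g)) ≤ k
  length-filter-tabulate-≤ {zero} g _ = z≤n
  length-filter-tabulate-≤ {suc n} g {k} bound with P? (g zero)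
  ... | no _ = length-filter-tabulate-≤ (g ∘ suc) (λ j p → ℕ.<⇒≤ (bound (suc j) p))
  length-filter-tabulate-≤ {suc n} g {zero} bound | yes p = contradiction (bound zero p) λ ()
  length-filter-tabulate-≤ {suc n} g {suc k} bound | yes _ =
    s≤s (length-filter-tabulate-≤ (g ∘ suc) (λ j p → ℕ.s≤s⁻¹ (bound (suc j) p)))

length-filter-mono : ∀ {A : Set} {P Q : Pred A 0ℓ} (P? : Decidable P) (Q? : Decidable Q) →
                     P ⊆ Q → ∀ xs → length (filter P? xs) ≤ length (filter Q? xs)
length-filter-mono P? Q? P⊆Q xs = length-mono-≤ (filter⁺ P? Q? (λ { refl → P⊆Q }) (⊆-refl {x = xs}))

module _ {A : Set} {_<_ : Rel A 0ℓ} (sto : IsStrictTotalOrder _≡_ _<_) where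
  open IsStrictTotalOrder sto using (compare; asym; irrefl) renaming (trans to <-trans)

  ≼-trans : Transitive (_≼_ _<_)
  ≼-trans = StrictToNonStrict.trans _≡_ _<_ isEquivalence (resp₂ _<_) <-trans

  ≼⇒≯ : ∀ {x y} → _≼_ _<_ x y → ¬ y < x
  ≼⇒≯ (inj₁ x<y)  = asym x<y
  ≼⇒≯ (inj₂ refl) = irrefl refl

  <-immSucc⇒≼ : ∀ {a b x} → ImmSucc _<_ a b → x < b → _≼_ _<_ x a
  <-immSucc⇒≼ {a} {x = x} (_ , nothing-between) x<b with compare x a
  ... | tri< x<a _ _ = inj₁ x<a
  ... | tri≈ _ x≡a _ = inj₂ x≡a
  ... | tri> _ _ a<x = contradiction (a<x , x<b) (nothing-between x)

module _ {N : ℕ} {_<_ : Rel (Fin N) 0ℓ} (sto : IsStrictTotalOrder _≡_ _<_)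
         {X : Pred (Fin N) 0ℓ} (X? : Decidable X) where
  private
    strictTotalOrder : StrictTotalOrder 0ℓ 0ℓ 0ℓ
    strictTotalOrder = record { isStrictTotalOrder = sto }

    open Extrema (DecTotalOrder.totalOrder (StrictTotalOrderProperties.decTotalOrder strictTotalOrder))

    Xs : List (Fin N)
    Xs = filter X? (allFin N)

    ∈Xs : ∀ {e} → X e → e ∈ Xs
    ∈Xs {e} = ∈-filter⁺ X? (∈-allFin e)

  max-exists : ∃ X → ∃ (IsMax _<_ X)
  max-exists (e₀ , Xe₀) =
    max e₀ Xs , argmax-all id Xe₀ (all-filter X? (allFin N)) ,
    λ e Xe → lookup (xs≤max e₀ Xs) (∈Xs Xe)

  min-exists : ∃ X → ∃ (IsMin _<_ X)
  min-exists (e₀ , Xe₀) =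
    min e₀ Xs , argmin-all id Xe₀ (all-filter X? (allFin N)) ,
    λ e Xe → lookup (min≤xs e₀ Xs) (∈Xs Xe)

module OrderEmbedding
  {A C : Set} {_<_ : Rel A 0ℓ} {_⊏_ : Rel C 0ℓ}
  (<-sto : IsStrictTotalOrder _≡_ _<_) (⊏-asym : Asymmetric _⊏_)
  (Lift : A → C → Set)
  (lift-unique : ∀ {e e' c c'} → Lift e c → Lift e' c' → e ≡ e' → c ≡ c')
  (lift-mono : ∀ {e e' c c'} → Lift e c → Lift e' c' → e < e' → c ⊏ c')
  where
  open IsStrictTotalOrder <-sto using (compare)

  Image : Pred A 0ℓ → Pred C 0ℓ → Set
  Image X Y = (∀ {e c} → X e → Lift e c → Y c) × (∀ {c} → Y c → ∃ λ e → X e × Lift e c)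

  lift-≼ : ∀ {e e' c c'} → Lift e c → Lift e' c' → _≼_ _<_ e e' → _≼_ _⊏_ c c'
  lift-≼ l l' (inj₁ e<e') = inj₁ (lift-mono l l' e<e')
  lift-≼ l l' (inj₂ e≡e') = inj₂ (lift-unique l l' e≡e')

  lift-reflects : ∀ {e e' c c'} → Lift e c → Lift e' c' → c ⊏ c' → e < e'
  lift-reflects {e} {e'} l l' c⊏c' with compare e e'
  ... | tri< e<e' _ _ = e<e'
  ... | tri≈ _ e≡e' _ with lift-unique l l' e≡e'
  ...   | refl = contradiction c⊏c' (⊏-asym c⊏c')
  lift-reflects l l' c⊏c' | tri> _ _ e'<e = contradiction (lift-mono l' l e'<e) (⊏-asym c⊏c')

  isMax-lift : ∀ {X Y a c} → Image X Y → IsMax _<_ X a → Lift a c → IsMax _⊏_ Y c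
  isMax-lift (X⇒Y , Y⇒X) (Xa , a-max) la = X⇒Y Xa la , λ d Yd →
    let (e , Xe , le) = Y⇒X Yd in lift-≼ le la (a-max e Xe)

  isMin-lift : ∀ {X Y b c} → Image X Y → IsMin _<_ X b → Lift b c → IsMin _⊏_ Y c
  isMin-lift (X⇒Y , Y⇒X) (Xb , b-min) lb = X⇒Y Xb lb , λ d Yd →
    let (e , Xe , le) = Y⇒X Yd in lift-≼ lb le (b-min e Xe)

  immSucc-lift : ∀ {a b c d} → ImmSucc _<_ a b → Lift a c → Lift b d →
                 (∀ {x} → c ⊏ x → x ⊏ d → ∃ λ e → Lift e x) → ImmSucc _⊏_ c d
  immSucc-lift (a<b , nothing-between) la lb between-lifts = lift-mono la lb a<b , λ x (c⊏x , x⊏d) →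
    let (e , le) = between-lifts c⊏x x⊏d in
    nothing-between e (lift-reflects la le c⊏x , lift-reflects le lb x⊏d)

module _ (G : AdmUPOGraph) where
  open AdmUPOGraph G

  maxIn-minOut-immSucc : ∀ {w a b} → IsMax _≺_ (Iv s t w) a → IsMin _≺_ (Ov s t w) b →
                         ImmSucc _≺_ a b
  maxIn-minOut-immSucc {w} {a} {b} (ta , a-max) (sb , b-min) =
    upo-i a b (one (trans ta (sym sb))) , nothing-between
    where
    nothing-between : ∀ c → ¬ (a ≺ c × c ≺ b)
    nothing-between c (a≺c , c≺b)
      with upo-ii-⊆ w c (a , b , inj₂ ta , inj₁ sb , inj₁ a≺c , inj₁ c≺b)
    ... | inj₁ (_ , b' , _ , tb' , _ , c≼b') = ≼⇒≯ isSTO (≼-trans isSTO c≼b' (a-max b' tb')) a≺c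
    ... | inj₂ (a' , _ , sa' , _ , a'≼c , _) = ≼⇒≯ isSTO (≼-trans isSTO (b-min a' sa') a'≼c) c≺b

-- OutEnum G n o and InEnum G n i unfold to Enumerates G n o (isOutEdge G) and
-- Enumerates G n i (isInEdge G).
Enumerates : (G : AdmUPOGraph) (n : ℕ) → (Fin n → Fin (AdmUPOGraph.E G)) →
             (Fin (AdmUPOGraph.E G) → Bool) → Set
Enumerates G n f isF =
  (∀ k → isF (f k) ≡ true) ×
  (∀ j k → toℕ j < toℕ k → _≺_ G (f j) (f k)) ×
  (∀ e → isF e ≡ true → ∃ λ k → f k ≡ e)
  where open AdmUPOGraph

module Enumeration (G : AdmUPOGraph) (n : ℕ) (f : Fin n → Fin (AdmUPOGraph.E G))
                   (isF : Fin (AdmUPOGraph.E G) → Bool) (enum : Enumerates G n f isF) where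
  open AdmUPOGraph G using (_≺_; isSTO; _<?_)
  open IsStrictTotalOrder isSTO using (compare; asym; irrefl) renaming (trans to ≺-trans)

  f-isF : ∀ k → isF (f k) ≡ true
  f-isF = proj₁ enum

  f-strict : ∀ j k → toℕ j < toℕ k → f j ≺ f k
  f-strict = proj₁ (proj₂ enum)

  f-onto : ∀ e → isF e ≡ true → ∃ λ k → f k ≡ e
  f-onto = proj₂ (proj₂ enum)

  f-∉ : ∀ k → ¬ T (not (isF (f k)))
  f-∉ k rewrite f-isF k = id

  count : Fin (AdmUPOGraph.E G) → ℕ
  count = countBefore G n f

  f-reflects : ∀ {j k} → f j ≺ f k → toℕ j < toℕ k
  f-reflects {j} {k} fj≺fk with <-cmp (toℕ j) (toℕ k)
  ... | tri< j<k _ _ = j<k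
  ... | tri≈ _ j≡k _ = contradiction fj≺fk (irrefl (cong f (toℕ-injective j≡k)))
  ... | tri> _ _ k<j = contradiction (f-strict k j k<j) (asym fj≺fk)

  f-reflects-≼ : ∀ {j k} → _≼_ _≺_ (f j) (f k) → toℕ j ≤ toℕ k
  f-reflects-≼ fj≼fk = ℕ.≮⇒≥ (λ k<j → ≼⇒≯ isSTO fj≼fk (f-strict _ _ k<j))

  count-≤ : ∀ {e e'} → (∀ k → f k ≺ e → f k ≺ e') → count e ≤ count e'
  count-≤ {e} {e'} h = length-filter-mono (λ k → f k <? e) (λ k → f k <? e') (h _) (allFin n)

  count-bound : ∀ {e m} → (∀ j → f j ≺ e → toℕ j < m) → count e ≤ m
  count-bound {e} = length-filter-tabulate-≤ (λ k → f k <? e) id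

  count-mono : ∀ {e e'} → e ≺ e' → count e ≤ count e'
  count-mono e≺e' = count-≤ (λ _ fk≺e → ≺-trans fk≺e e≺e')

  <-count : ∀ {j e} → f j ≺ e → toℕ j < count e
  <-count {j} {e} fj≺e = length-filter-tabulate-≥ (λ k → f k <? e) id (toℕ<n j) below
    where
    below : ∀ l → toℕ l < suc (toℕ j) → f l ≺ e
    below l l≤j with m≤n⇒m<n∨m≡n (ℕ.s≤s⁻¹ l≤j)
    ... | inj₁ l<j = ≺-trans (f-strict l j l<j) fj≺e
    ... | inj₂ l≡j rewrite toℕ-injective l≡j = fj≺e

  count-f : ∀ k → count (f k) ≡ toℕ k
  count-f k = ℕ.≤-antisym (count-bound (λ j → f-reflects))
                          (length-filter-tabulate-≥ (λ j → f j <? f k) id (ℕ.<⇒≤ (toℕ<n k)) (λ j → f-strict j k))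

  count-immSucc : ∀ {a b} → ImmSucc _≺_ a b → T (not (isF a)) → count b ≤ count a
  count-immSucc a⋖b a∉F = count-≤ λ k fk≺b → case <-immSucc⇒≼ isSTO a⋖b fk≺b of λ where
    (inj₁ fk≺a) → fk≺a
    (inj₂ refl) → ⊥-elim (f-∉ k a∉F)

  count-immSucc-f : ∀ {k b} → ImmSucc _≺_ (f k) b → count b ≤ suc (toℕ k)
  count-immSucc-f a⋖b = count-bound λ j fj≺b → s≤s (f-reflects-≼ (<-immSucc⇒≼ isSTO a⋖b fj≺b))

  f-injective : ∀ {j k} → f j ≡ f k → j ≡ k
  f-injective {j} {k} fj≡fk = toℕ-injective (begin
    toℕ j      ≡⟨ count-f j ⟨
    count (f j) ≡⟨ cong count fj≡fk ⟩
    count (f k) ≡⟨ count-f k ⟩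
    toℕ k      ∎)
    where open ≡-Reasoning

module Composite (G₁ G₂ : AdmUPOGraph) (n : ℕ)
                 (o : Fin n → Fin (AdmUPOGraph.E G₁)) (i : Fin n → Fin (AdmUPOGraph.E G₂))
                 (oE : OutEnum G₁ n o) (iE : InEnum G₂ n i) where
  open Compose G₁ G₂ n o i
  open AdmUPOGraph using (E; s; t; σ; _≺_; isSTO; isOutEdge; isInEdge)
  module O = Enumeration G₁ n o (isOutEdge G₁) oE
  module I = Enumeration G₂ n i (isInEdge G₂) iE

  block tag : CEdge → ℕ
  block = proj₁ ∘ key
  tag   = proj₂ ∘ key

  within-asym : Asymmetric within
  within-asym {qE _ _} {qE _ _} = IsStrictTotalOrder.asym (isSTO G₁)
  within-asym {qE _ _} {bar _}  ()
  within-asym {qE _ _} {pE _ _} ()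
  within-asym {bar _}           ()
  within-asym {pE _ _} {qE _ _} ()
  within-asym {pE _ _} {bar _}  ()
  within-asym {pE _ _} {pE _ _} = IsStrictTotalOrder.asym (isSTO G₂)

  ≺c-asym : Asymmetric _≺c_
  ≺c-asym {x} {y} =
    ×-asymmetric {_≈₁_ = _≡_} {_<₁_ = _<lex_} {_<₂_ = within}
      sym (resp₂ _<lex_) <lex-asym (λ {x} {y} → within-asym {x} {y}) {key x , x} {key y , y}
    where
    <lex-asym : Asymmetric _<lex_
    <lex-asym = ×-asymmetric {_≈₁_ = _≡_} {_<₁_ = _<_} {_<₂_ = _<_} sym (resp₂ _<_) ℕ.<-asym ℕ.<-asym

  ≺c⇒block≤ : ∀ x y → x ≺c y → block x ≤ block y
  ≺c⇒block≤ _ _ (inj₁ (inj₁ bx<by))     = ℕ.<⇒≤ bx<by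
  ≺c⇒block≤ _ _ (inj₁ (inj₂ (bx≡by , _))) = ℕ.≤-reflexive bx≡by
  ≺c⇒block≤ _ _ (inj₂ (kx≡ky , _))      = ℕ.≤-reflexive (cong proj₁ kx≡ky)

  ≺c⇒block< : ∀ x y → x ≺c y → tag y < tag x → block x < block y
  ≺c⇒block< _ _ (inj₁ (inj₁ bx<by))      _     = bx<by
  ≺c⇒block< _ _ (inj₁ (inj₂ (_ , tx<ty))) ty<tx = contradiction ty<tx (ℕ.<-asym tx<ty)
  ≺c⇒block< _ _ (inj₂ (kx≡ky , _))       ty<tx = contradiction (cong proj₂ kx≡ky) (ℕ.>⇒≢ ty<tx)

  ≺c-block : ∀ x y → block x < block y → x ≺c y
  ≺c-block _ _ bx<by = inj₁ (inj₁ bx<by)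

  ≺c-tag : ∀ x y → block x ≤ block y → tag x < tag y → x ≺c y
  ≺c-tag x y bx≤by tx<ty with m≤n⇒m<n∨m≡n bx≤by
  ... | inj₁ bx<by = ≺c-block x y bx<by
  ... | inj₂ bx≡by = inj₁ (inj₂ (bx≡by , tx<ty))

  ≺c-within : ∀ x y → block x ≤ block y → tag x ≡ tag y → within x y → x ≺c y
  ≺c-within x y bx≤by tx≡ty w with m≤n⇒m<n∨m≡n bx≤by
  ... | inj₁ bx<by = ≺c-block x y bx<by
  ... | inj₂ bx≡by = inj₂ (cong₂ _,_ bx≡by tx≡ty , w)

  data Lift₁ : Fin (E G₁) → CEdge → Set where
    inner  : ∀ e p → Lift₁ e (qE e p)
    output : ∀ k → Lift₁ (o k) (bar k)

  lift₁ : ∀ e → ∃ (Lift₁ e)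
  lift₁ e with isOutEdge G₁ e in e-out
  ... | false = qE e (subst (T ∘ not) (sym e-out) _) , inner e _
  ... | true  = let (k , ok≡e) = O.f-onto e e-out in
                bar k , subst (λ e → Lift₁ e (bar k)) ok≡e (output k)

  lift₁-unique : ∀ {e e' c c'} → Lift₁ e c → Lift₁ e' c' → e ≡ e' → c ≡ c'
  lift₁-unique (inner e p) (inner _ q) refl = cong (qE e) (T-irrelevant p q)
  lift₁-unique (inner _ p) (output k) refl = ⊥-elim (O.f-∉ k p)
  lift₁-unique (output k) (inner _ p) refl = ⊥-elim (O.f-∉ k p)
  lift₁-unique (output j) (output k) oj≡ok = cong bar (O.f-injective oj≡ok)

  block-lift₁ : ∀ {e c} → Lift₁ e c → block c ≡ O.count e
  block-lift₁ (inner _ _) = refl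
  block-lift₁ (output k)  = sym (O.count-f k)

  lift₁-mono : ∀ {e e' c c'} → Lift₁ e c → Lift₁ e' c' → _≺_ G₁ e e' → c ≺c c'
  lift₁-mono (inner _ p) (inner _ p') e≺e' = ≺c-within (qE _ p) (qE _ p') (O.count-mono e≺e') refl e≺e'
  lift₁-mono (inner _ p) (output k)   e≺e' =
    ≺c-tag (qE _ p) (bar k) (ℕ.≤-trans (O.count-mono e≺e') (ℕ.≤-reflexive (O.count-f k))) (s≤s z<s)
  lift₁-mono (output j) (inner _ p)   e≺e' = ≺c-block (bar j) (qE _ p) (O.<-count e≺e')
  lift₁-mono (output j) (output k)    e≺e' = ≺c-block (bar j) (bar k) (O.f-reflects e≺e')

  data Lift₂ : Fin (E G₂) → CEdge → Set where
    inner : ∀ e p → Lift₂ e (pE e p)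
    input : ∀ k → Lift₂ (i k) (bar k)

  lift₂ : ∀ e → ∃ (Lift₂ e)
  lift₂ e with isInEdge G₂ e in e-in
  ... | false = pE e (subst (T ∘ not) (sym e-in) _) , inner e _
  ... | true  = let (k , ik≡e) = I.f-onto e e-in in
                bar k , subst (λ e → Lift₂ e (bar k)) ik≡e (input k)

  lift₂-unique : ∀ {e e' c c'} → Lift₂ e c → Lift₂ e' c' → e ≡ e' → c ≡ c'
  lift₂-unique (inner e p) (inner _ q) refl = cong (pE e) (T-irrelevant p q)
  lift₂-unique (inner _ p) (input k) refl = ⊥-elim (I.f-∉ k p)
  lift₂-unique (input k) (inner _ p) refl = ⊥-elim (I.f-∉ k p)
  lift₂-unique (input j) (input k) ij≡ik = cong bar (I.f-injective ij≡ik)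

  lift₂-mono : ∀ {e e' c c'} → Lift₂ e c → Lift₂ e' c' → _≺_ G₂ e e' → c ≺c c'
  lift₂-mono (inner _ p) (inner _ p') e≺e' = ≺c-within (pE _ p) (pE _ p') (I.count-mono e≺e') refl e≺e'
  lift₂-mono (inner _ p) (input k)    e≺e' =
    ≺c-tag (pE _ p) (bar k) (ℕ.≤-trans (I.count-mono e≺e') (ℕ.≤-reflexive (I.count-f k))) z<s
  lift₂-mono (input j) (inner _ p)    e≺e' = ≺c-block (bar j) (pE _ p) (I.<-count e≺e')
  lift₂-mono (input j) (input k)      e≺e' = ≺c-block (bar j) (bar k) (I.f-reflects e≺e')

  module L₁ = OrderEmbedding (isSTO G₁) ≺c-asym Lift₁ lift₁-unique lift₁-mono
  module L₂ = OrderEmbedding (isSTO G₂) ≺c-asym Lift₂ lift₂-unique lift₂-mono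

  Inner₁ : Fin (AdmUPOGraph.V G₁) → Set
  Inner₁ w = T (not (σ G₁ w))

  Inner₂ : Fin (AdmUPOGraph.V G₂) → Set
  Inner₂ w = T (not (σ G₂ w))

  tgt₁-inner : ∀ {c w} → tgt c ≡ inj₁ w → Inner₁ w
  tgt₁-inner {qE e p} te≡w = subst Inner₁ (inj₁-injective te≡w) p

  src₂-inner : ∀ {c w} → src c ≡ inj₂ w → Inner₂ w
  src₂-inner {pE e p} se≡w = subst Inner₂ (inj₂-injective se≡w) p

  in₁-image : ∀ {w} → Inner₁ w → L₁.Image (Iv (s G₁) (t G₁) w) (Ic (inj₁ w))
  in₁-image {w} w-inner = lift-in , in-lift
    where
    lift-in : ∀ {e c} → t G₁ e ≡ w → Lift₁ e c → Ic (inj₁ w) c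
    lift-in te≡w (inner _ _) = cong inj₁ te≡w
    lift-in te≡w (output k)  = ⊥-elim (O.f-∉ k (subst Inner₁ (sym te≡w) w-inner))
    in-lift : ∀ {c} → Ic (inj₁ w) c → ∃ λ e → t G₁ e ≡ w × Lift₁ e c
    in-lift {qE e p} te≡w = e , inj₁-injective te≡w , inner e p

  out₁-image : ∀ {w} → L₁.Image (Ov (s G₁) (t G₁) w) (Oc (inj₁ w))
  out₁-image {w} = lift-out , out-lift
    where
    lift-out : ∀ {e c} → s G₁ e ≡ w → Lift₁ e c → Oc (inj₁ w) c
    lift-out se≡w (inner _ _) = cong inj₁ se≡w
    lift-out se≡w (output _)  = cong inj₁ se≡w
    out-lift : ∀ {c} → Oc (inj₁ w) c → ∃ λ e → s G₁ e ≡ w × Lift₁ e c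
    out-lift {qE e p} se≡w = e , inj₁-injective se≡w , inner e p
    out-lift {bar k}  se≡w = o k , inj₁-injective se≡w , output k

  in₂-image : ∀ {w} → L₂.Image (Iv (s G₂) (t G₂) w) (Ic (inj₂ w))
  in₂-image {w} = lift-in , in-lift
    where
    lift-in : ∀ {e c} → t G₂ e ≡ w → Lift₂ e c → Ic (inj₂ w) c
    lift-in te≡w (inner _ _) = cong inj₂ te≡w
    lift-in te≡w (input _)   = cong inj₂ te≡w
    in-lift : ∀ {c} → Ic (inj₂ w) c → ∃ λ e → t G₂ e ≡ w × Lift₂ e c
    in-lift {bar k}  te≡w = i k , inj₂-injective te≡w , input k
    in-lift {pE e p} te≡w = e , inj₂-injective te≡w , inner e p

  out₂-image : ∀ {w} → Inner₂ w → L₂.Image (Ov (s G₂) (t G₂) w) (Oc (inj₂ w))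
  out₂-image {w} w-inner = lift-out , out-lift
    where
    lift-out : ∀ {e c} → s G₂ e ≡ w → Lift₂ e c → Oc (inj₂ w) c
    lift-out se≡w (inner _ _) = cong inj₂ se≡w
    lift-out se≡w (input k)   = ⊥-elim (I.f-∉ k (subst Inner₂ (sym se≡w) w-inner))
    out-lift : ∀ {c} → Oc (inj₂ w) c → ∃ λ e → s G₂ e ≡ w × Lift₂ e c
    out-lift {pE e p} se≡w = e , inj₂-injective se≡w , inner e p

  between-lift₁ : ∀ {a b p B c} → ImmSucc (_≺_ G₁) a b → Lift₁ b B → qE a p ≺c c → c ≺c B →
         ∃ λ e → Lift₁ e c
  between-lift₁ {c = qE e p} _ _ _ _ = e , inner e p
  between-lift₁ {c = bar k}  _ _ _ _ = o k , output k
  between-lift₁ {a} {b} {p} {B} {c@(pE e _)} a⋖b lb a≺c c≺B = ⊥-elim (ℕ.<-irrefl refl (begin-strict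
    O.count a  <⟨ ≺c⇒block< (qE a p) c a≺c z<s ⟩
    I.count e  ≤⟨ ≺c⇒block≤ c B c≺B ⟩
    block B    ≡⟨ block-lift₁ lb ⟩
    O.count b  ≤⟨ O.count-immSucc a⋖b p ⟩
    O.count a  ∎))
    where open ℕ.≤-Reasoning

  between-lift₂ : ∀ {a b A p c} → ImmSucc (_≺_ G₂) a b → Lift₂ a A → A ≺c c → c ≺c pE b p →
         ∃ λ e → Lift₂ e c
  between-lift₂ {c = pE e p} _ _ _ _ = e , inner e p
  between-lift₂ {c = bar k}  _ _ _ _ = i k , input k
  between-lift₂ {a} {b} {p = p} {c@(qE e _)} a⋖b (inner _ q) A≺c c≺B = ⊥-elim (ℕ.<-irrefl refl (begin-strict
    I.count b  ≤⟨ I.count-immSucc a⋖b q ⟩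
    I.count a  ≤⟨ ≺c⇒block≤ (pE a q) c A≺c ⟩
    O.count e  <⟨ ≺c⇒block< c (pE b p) c≺B z<s ⟩
    I.count b  ∎))
    where open ℕ.≤-Reasoning
  between-lift₂ {b = b} {p = p} {c@(qE e _)} a⋖b (input k) A≺c c≺B = ⊥-elim (ℕ.<-irrefl refl (begin-strict
    I.count b    ≤⟨ I.count-immSucc-f a⋖b ⟩
    suc (toℕ k)  ≤⟨ ≺c⇒block< (bar k) c A≺c (s≤s z<s) ⟩
    O.count e    <⟨ ≺c⇒block< c (pE b p) c≺B z<s ⟩
    I.count b    ∎))
    where open ℕ.≤-Reasoning

  MinOutSucceedsMaxIn : CVert → Set
  MinOutSucceedsMaxIn v = ∃ λ a → ∃ λ b →
    IsMax _≺c_ (Ic v) a × IsMin _≺c_ (Oc v) b × ImmSucc _≺c_ a b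

  processive₁ : ∀ w → Processive (inj₁ w) → MinOutSucceedsMaxIn (inj₁ w)
  processive₁ w ((c₀ , c₀-in) , (c₁ , c₁-out)) =
    let w-inner        = tgt₁-inner c₀-in
        (e₀ , te₀ , _) = proj₂ (in₁-image w-inner) c₀-in
        (e₁ , se₁ , _) = proj₂ out₁-image c₁-out
        (a , a-max)    = max-exists (isSTO G₁) (λ e → t G₁ e ≟ w) (e₀ , te₀)
        (b , b-min)    = min-exists (isSTO G₁) (λ e → s G₁ e ≟ w) (e₁ , se₁)
        a⋖b            = maxIn-minOut-immSucc G₁ a-max b-min
        a-inner        = subst Inner₁ (sym (proj₁ a-max)) w-inner
        (B , lb)       = lift₁ b
    in qE a a-inner , B ,
       L₁.isMax-lift (in₁-image w-inner) a-max (inner a a-inner) ,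
       L₁.isMin-lift out₁-image b-min lb ,
       L₁.immSucc-lift a⋖b (inner a a-inner) lb (between-lift₁ a⋖b lb)

  processive₂ : ∀ w → Processive (inj₂ w) → MinOutSucceedsMaxIn (inj₂ w)
  processive₂ w ((c₀ , c₀-in) , (c₁ , c₁-out)) =
    let w-inner        = src₂-inner c₁-out
        (e₀ , te₀ , _) = proj₂ in₂-image c₀-in
        (e₁ , se₁ , _) = proj₂ (out₂-image w-inner) c₁-out
        (a , a-max)    = max-exists (isSTO G₂) (λ e → t G₂ e ≟ w) (e₀ , te₀)
        (b , b-min)    = min-exists (isSTO G₂) (λ e → s G₂ e ≟ w) (e₁ , se₁)
        a⋖b            = maxIn-minOut-immSucc G₂ a-max b-min
        b-inner        = subst Inner₂ (sym (proj₁ b-min)) w-inner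
        (A , la)       = lift₂ a
    in A , pE b b-inner ,
       L₂.isMax-lift in₂-image a-max la ,
       L₂.isMin-lift (out₂-image w-inner) b-min (inner b b-inner) ,
       L₂.immSucc-lift a⋖b la (inner b b-inner) (between-lift₂ a⋖b la)

lemma5p3 : (G₁ G₂ : AdmUPOGraph) (n : ℕ)
    (o : Fin n → Fin (AdmUPOGraph.E G₁)) (i : Fin n → Fin (AdmUPOGraph.E G₂)) →
    OutEnum G₁ n o → InEnum G₂ n i →
    ∀ (v : Compose.CVert G₁ G₂ n o i) → Compose.Processive G₁ G₂ n o i v →
    ∃ λ a → ∃ λ b →
      IsMax (Compose._≺c_ G₁ G₂ n o i) (Compose.Ic G₁ G₂ n o i v) a ×
      IsMin (Compose._≺c_ G₁ G₂ n o i) (Compose.Oc G₁ G₂ n o i v) b ×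
      ImmSucc (Compose._≺c_ G₁ G₂ n o i) a b
lemma5p3 G₁ G₂ n o i oE iE (inj₁ w) = Composite.processive₁ G₁ G₂ n o i oE iE w
lemma5p3 G₁ G₂ n o i oE iE (inj₂ w) = Composite.processive₂ G₁ G₂ n o i oE iE w
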